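{- Let $L \subseteq \mathbb{N}$ be an infinite porous set. Then there does not exist a function $f:\mathbb{N}\to\mathbb{N}$ such that for all $k \in \mathbb{N}$ and all graphs $G$, either $G$ contains $k$ pairwise vertex-disjoint $L$-cycles, or there is a set $X \subseteq V(G)$ with $|X| \leq f(k)$ such that the set $\{\,|C| : C \text{ is an } L\text{ -cycle of } G - X\,\}$ of cycle lengths from $L$ occurring in $G-X$ has at most $f(k)$ elements.
   Context: $\mathbb{N}$ denotes the set of positive integers. Graphs are finite. For $L \subseteq \mathbb{N}$, an $L$-cycle is a cycle whose length (number of edges, denoted $|C|$) lies in $L$. A set $L \subseteq \mathbb{N}$ is porous if for every $n \in \mathbb{N}$, the set $\mathbb{N}\setminus L$ contains $n$ consecutive integers. -}

module Defs where

open import Level using (0ℓ)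
open import Data.Nat using (ℕ; zero; suc; _+_; _≤_; _<_)
open import Data.Fin using (Fin; zero; suc; inject₁; fromℕ)
open import Data.Fin.Subset using (Subset; _∉_; ∣_∣)
open import Data.List using (List; length)
open import Data.List.Membership.Propositional using (_∈_)
open import Data.Product using (Σ; ∃; _×_; _,_)
open import Data.Sum using (_⊎_)
open import Function.Definitions using (Injective)
open import Relation.Binary.PropositionalEquality using (_≡_)
open import Relation.Nullary using (¬_)

-- Sets of positive integers are represented as predicates on ℕ
-- (membership of 0 is irrelevant: only positive integers are ever tested).

Infinite : (ℕ → Set) → Set
Infinite L = ∀ n → ∃ λ m → n ≤ m × L m

Porous : (ℕ → Set) → Set
Porous L = ∀ n → ∃ λ a → 1 ≤ a × (∀ i → i < n → ¬ L (a + i))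

record Graph : Set₁ where
  field
    n     : ℕ
    Adj   : Fin n → Fin n → Set
    sym   : ∀ {u v} → Adj u v → Adj v u
    irrefl : ∀ {u} → ¬ Adj u u

module _ (G : Graph) where
  open Graph G

  record Cycle : Set where
    field
      len-1   : ℕ
      vert    : Fin (suc len-1) → Fin n
      long    : 3 ≤ suc len-1
      distinct : Injective _≡_ _≡_ vert
      step    : ∀ (i : Fin len-1) → Adj (vert (inject₁ i)) (vert (suc i))
      close   : Adj (vert (fromℕ len-1)) (vert zero)

    len : ℕ
    len = suc len-1

  open Cycle public

  LCycle : (ℕ → Set) → Cycle → Set
  LCycle L C = L (len C)

  Avoids : Subset n → Cycle → Set
  Avoids X C = ∀ i → vert C i ∉ X

  Disjoint : Cycle → Cycle → Set
  Disjoint C D = ∀ i j → ¬ (vert C i ≡ vert D j)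

  HasDisjointLCycles : (ℕ → Set) → ℕ → Set
  HasDisjointLCycles L k =
    Σ (Fin k → Cycle) λ Cs →
      (∀ a → LCycle L (Cs a)) × (∀ a b → ¬ (a ≡ b) → Disjoint (Cs a) (Cs b))

  FewLengthsAfterDeleting : (ℕ → Set) → Subset n → ℕ → Set
  FewLengthsAfterDeleting L X t =
    Σ (List ℕ) λ ls → length ls ≤ t ×
      (∀ C → Avoids X C → LCycle L C → len C ∈ ls)

  SmallLengthHittingSet : (ℕ → Set) → ℕ → Set
  SmallLengthHittingSet L t =
    Σ (Subset n) λ X → ∣ X ∣ ≤ t × FewLengthsAfterDeleting L X t

module Submission where

-- Given f, we build for t = f 2 a graph without two disjoint L-cycles in which deleting any t vertices
-- leaves more than t lengths of L-cycles.  Let r = 3t + 2.  The branch vertices are the unordered pairs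
-- {k, s} of numbers below r, and for each k the r pairs containing k are joined cyclically by subdivided
-- paths into the block cycle k, so two block cycles k ≠ k′ share only the vertex {k, k′}.  Deleting t
-- vertices thus destroys at most 2t block cycles, and the remaining r − 2t > t ones have pairwise distinct
-- lengths in L.
-- The path lengths grow so fast that the length of a cycle is pinned down by its highest path, and they are
-- chosen, using that L is infinite and porous, so that only a cycle through a whole block can have its
-- length in L; hence no two L-cycles are disjoint.  Choosing them needs the least element of L beyond a
-- bound, which is classical, but as the goal is a negation the choice can be made in the double-negation
-- monad.

open import Defs
open import Data.Empty using (⊥; ⊥-elim)
open import Data.Fin as Fin using (Fin; zero; suc; toℕ; fromℕ; fromℕ<; inject₁; lower₁; splitAt; combine)
open import Data.Fin.Properties
  using (toℕ-fromℕ<; toℕ-injective; toℕ<n; toℕ-inject₁; toℕ-fromℕ; inject₁-lower₁; toℕ-lower₁; injective⇒≤;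
         join-splitAt; splitAt-join; any?; combine-injective)
  renaming (suc-injective to Fin-suc-injective)
open import Data.Fin.Subset using (Subset; inside; outside; ∣_∣) renaming (_∈_ to _∈ₛ_)
open import Data.Fin.Subset.Properties using (_∈?_)
open import Data.List using (List; length; lookup)
open import Data.List.Membership.Propositional using (_∈_)
open import Data.List.Relation.Unary.Any using (index)
open import Data.List.Relation.Unary.Any.Properties using (lookup-index)
open import Data.Nat
open import Data.Nat.DivMod
  using (_/_; _%_; +-distrib-/-∣ˡ; m*n/n≡m; m<n⇒m/n≡0; [m+kn]%n≡m%n; m<n⇒m%n≡m; m<n*o⇒m/o<n; m%n<n;
         n%n≡0; m≡m%n+[m/n]*n; m/n*n≤m)
open import Data.Nat.Divisibility using (divides-refl)
open import Data.Nat.Properties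
open import Data.Nat.Solver using (module +-*-Solver)
open import Data.Product using (Σ; ∃; ∃₂; _×_; _,_; proj₁; proj₂)
open import Data.Sum using (_⊎_; inj₁; inj₂; [_,_]′; swap)
open import Data.Sum.Properties using (inj₁-injective; inj₂-injective)
open import Data.Unit using (⊤; tt)
open import Data.Vec using (_∷_; here; there)
open import Effect.Monad using (RawMonad)
open import Function using (_∘_; case_of_)
open import Function.Definitions using (Injective)
open import Level using (0ℓ)
open import Relation.Binary.Definitions using (tri<; tri≈; tri>)
open import Relation.Binary.PropositionalEquality
open import Relation.Nullary using (¬_; yes; no; ¬¬-excluded-middle)
open import Relation.Nullary.Decidable using (_×-dec_; decidable-stable)
open import Relation.Nullary.Negation using (¬¬-Monad)

[,]-injective : ∀ {A B C : Set} {f : A → C} {g : B → C} →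
                Injective _≡_ _≡_ f → Injective _≡_ _≡_ g → (∀ a b → f a ≢ g b) →
                Injective _≡_ _≡_ [ f , g ]′
[,]-injective f-inj g-inj f≢g {inj₁ a} {inj₁ a′} eq = cong inj₁ (f-inj eq)
[,]-injective f-inj g-inj f≢g {inj₁ a} {inj₂ b}  eq = ⊥-elim (f≢g a b eq)
[,]-injective f-inj g-inj f≢g {inj₂ b} {inj₁ a}  eq = ⊥-elim (f≢g a b (sym eq))
[,]-injective f-inj g-inj f≢g {inj₂ b} {inj₂ b′} eq = cong inj₂ (g-inj eq)

splitAt-injective : ∀ m {n} → Injective _≡_ _≡_ (splitAt m {n})
splitAt-injective m {n} {i} {j} eq =
  trans (sym (join-splitAt m n i)) (trans (cong (Fin.join m n) eq) (join-splitAt m n j))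

join-injective : ∀ m n → Injective _≡_ _≡_ (Fin.join m n)
join-injective m n {x} {y} eq =
  trans (sym (splitAt-join m n x)) (trans (cong (splitAt m) eq) (splitAt-join m n y))

bounded-injection⇒≤ : ∀ {a} P (h : Fin a → ℕ) → (∀ i → h i < P) → Injective _≡_ _≡_ h → a ≤ P
bounded-injection⇒≤ P h h<P h-inj = injective⇒≤ {f = λ i → fromℕ< (h<P i)} λ {i} {j} eq →
  h-inj (trans (sym (toℕ-fromℕ< (h<P i))) (trans (cong toℕ eq) (toℕ-fromℕ< (h<P j))))

-- The a values of h together with the c values of the gap [Q, Q + c) are a + c distinct numbers below P.
gapped-injection⇒≤ : ∀ {a} P Q c (h : Fin a → ℕ) → (∀ i → h i < P) → Injective _≡_ _≡_ h →
                     (∀ i → h i < Q ⊎ Q + c ≤ h i) → Q + c ≤ P → a + c ≤ P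
gapped-injection⇒≤ {a} P Q c h h<P h-inj h∉gap Q+c≤P =
  bounded-injection⇒≤ P (h⁺ ∘ splitAt a) (h⁺<P ∘ splitAt a) (splitAt-injective a ∘ h⁺-inj)
  where
  gap : Fin c → ℕ
  gap j = Q + toℕ j
  h⁺ : Fin a ⊎ Fin c → ℕ
  h⁺ = [ h , gap ]′
  h⁺<P : ∀ x → h⁺ x < P
  h⁺<P (inj₁ i) = h<P i
  h⁺<P (inj₂ j) = <-≤-trans (+-monoʳ-< Q (toℕ<n j)) Q+c≤P
  h≢gap : ∀ i j → h i ≢ gap j
  h≢gap i j eq with h∉gap i
  ... | inj₁ hi<Q = <⇒≱ hi<Q (subst (Q ≤_) (sym eq) (m≤m+n Q (toℕ j)))
  ... | inj₂ Q+c≤hi = <⇒≱ (+-monoʳ-< Q (toℕ<n j)) (subst (Q + c ≤_) eq Q+c≤hi)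
  h⁺-inj : Injective _≡_ _≡_ h⁺
  h⁺-inj = [,]-injective h-inj (toℕ-injective ∘ +-cancelˡ-≡ Q _ _) h≢gap

covering⇒≤ : ∀ {a} Q c (h : Fin a → ℕ) → (∀ p → p < c → ∃ λ i → h i ≡ Q + p) → c ≤ a
covering⇒≤ Q c h cover = injective⇒≤ {f = preimage} λ {p} {p′} eq →
  toℕ-injective (+-cancelˡ-≡ Q _ _
    (trans (sym (proj₂ (cover′ p))) (trans (cong h eq) (proj₂ (cover′ p′)))))
  where
  cover′ : ∀ (p : Fin c) → ∃ λ i → h i ≡ Q + toℕ p
  cover′ p = cover (toℕ p) (toℕ<n p)
  preimage : Fin c → Fin _
  preimage p = proj₁ (cover′ p)

argmax : ∀ {l} (f : Fin (suc l) → ℕ) → ∃ λ i → ∀ j → f j ≤ f i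
argmax {zero} f = zero , λ { zero → ≤-refl }
argmax {suc l} f with argmax (f ∘ suc)
... | i , max with f zero ≤? f (suc i)
... | yes f0≤ = suc i , λ { zero → f0≤ ; (suc j) → max j }
... | no f0≰ = zero , λ { zero → ≤-refl ; (suc j) → ≤-trans (max j) (<⇒≤ (≰⇒> f0≰)) }

⊓+⊔ : ∀ m n → m ⊓ n + (m ⊔ n) ≡ m + n
⊓+⊔ m n with ≤-total m n
... | inj₁ m≤n = cong₂ _+_ (m≤n⇒m⊓n≡m m≤n) (m≤n⇒m⊔n≡n m≤n)
... | inj₂ n≤m = trans (cong₂ _+_ (m≥n⇒m⊓n≡n n≤m) (m≥n⇒m⊔n≡m n≤m)) (+-comm n m)

rank : ∀ {n} (p : Subset n) {v} → v ∈ₛ p → Fin ∣ p ∣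
rank (inside ∷ p) here = zero
rank (inside ∷ p) (there v∈p) = suc (rank p v∈p)
rank (outside ∷ p) (there v∈p) = rank p v∈p

rank-injective : ∀ {n} (p : Subset n) {v w} (v∈p : v ∈ₛ p) (w∈p : w ∈ₛ p) →
                 rank p v∈p ≡ rank p w∈p → v ≡ w
rank-injective (inside ∷ p) here here _ = refl
rank-injective (inside ∷ p) (there v∈p) (there w∈p) eq =
  cong suc (rank-injective p v∈p w∈p (Fin-suc-injective eq))
rank-injective (outside ∷ p) (there v∈p) (there w∈p) eq = cong suc (rank-injective p v∈p w∈p eq)
rank-injective (inside ∷ p) here (there w∈p) ()
rank-injective (inside ∷ p) (there v∈p) here ()

module _ {G : Graph} (C : Cycle G) where
  open Graph G using (Adj)
  private
    l : ℕ
    l = len-1 C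

    next : Fin (suc l) → Fin (suc l)
    next j with l ≟ toℕ j
    ... | yes _ = zero
    ... | no l≢j = suc (lower₁ j l≢j)

    prev : Fin (suc l) → Fin (suc l)
    prev zero = fromℕ l
    prev (suc i) = inject₁ i

    adj-next : ∀ j → Adj (vert C j) (vert C (next j))
    adj-next j with l ≟ toℕ j
    ... | yes l≡j = subst (λ i → Adj (vert C i) (vert C zero)) (toℕ-injective (trans (toℕ-fromℕ l) l≡j)) (close C)
    ... | no l≢j = subst (λ i → Adj (vert C i) (vert C (suc (lower₁ j l≢j)))) (inject₁-lower₁ j l≢j)
                         (step C (lower₁ j l≢j))

    adj-prev : ∀ j → Adj (vert C j) (vert C (prev j))
    adj-prev zero = Graph.sym G (close C)
    adj-prev (suc i) = Graph.sym G (step C i)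

    2≤l : 2 ≤ l
    2≤l = s≤s⁻¹ (long C)

    next≢prev : ∀ j → next j ≢ prev j
    next≢prev j next≡prev with l ≟ toℕ j | cong toℕ next≡prev
    next≢prev zero    _ | yes l≡0 | _ = <⇒≢ (<-≤-trans (s≤s z≤n) 2≤l) (sym l≡0)
    next≢prev zero    _ | no l≢0  | e =
      <⇒≢ 2≤l (trans (cong suc (sym (toℕ-lower₁ zero l≢0))) (trans e (toℕ-fromℕ l)))
    next≢prev (suc i) _ | yes l≡j | e = <⇒≢ 2≤l (sym (trans l≡j (cong suc (sym (trans e (toℕ-inject₁ i))))))
    next≢prev (suc i) _ | no l≢j  | e =
      <⇒≢ (m<n⇒m<1+n (n<1+n (toℕ i)))
          (sym (trans (cong suc (sym (toℕ-lower₁ (suc i) l≢j))) (trans e (toℕ-inject₁ i))))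

  two-neighbours : ∀ i → ∃₂ λ j j′ → j ≢ j′ × Adj (vert C i) (vert C j) × Adj (vert C i) (vert C j′)
  two-neighbours i = next i , prev i , next≢prev i , adj-next i , adj-prev i

cycleFromClosedWalk : (G : Graph) (m : ℕ) (w : ℕ → ℕ) →
                      (∀ {i} → i < m → w i < Graph.n G) → (∀ {i j} → i < m → j < m → w i ≡ w j → i ≡ j) →
                      (R : ℕ → ℕ → Set) → (∀ {u v} → R (toℕ u) (toℕ v) → Graph.Adj G u v) →
                      (∀ {i} → i < m → R (w i) (w (suc i))) → w m ≡ w 0 → 3 ≤ m →
                      Σ (Cycle G) λ C → len C ≡ m × (∀ i → toℕ (vert C i) ≡ w (toℕ i))
cycleFromClosedWalk G (suc l) w w<n w-inj R R⇒Adj w-step closed (s≤s 2≤l) =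
  record { len-1 = l ; vert = vertex ; long = s≤s 2≤l ; distinct = vertex-inj
         ; step = vertex-step ; close = vertex-close } ,
  refl , toℕ-vertex
  where
  vertex : Fin (suc l) → Fin (Graph.n G)
  vertex i = fromℕ< (w<n (toℕ<n i))
  toℕ-vertex : ∀ i → toℕ (vertex i) ≡ w (toℕ i)
  toℕ-vertex i = toℕ-fromℕ< _
  vertex-inj : Injective _≡_ _≡_ vertex
  vertex-inj {i} {j} eq = toℕ-injective (w-inj (toℕ<n i) (toℕ<n j)
    (trans (sym (toℕ-vertex i)) (trans (cong toℕ eq) (toℕ-vertex j))))
  R⇒Adj-vertex : ∀ {i j} → R (w (toℕ i)) (w (toℕ j)) → Graph.Adj G (vertex i) (vertex j)
  R⇒Adj-vertex {i} {j} = R⇒Adj ∘ subst₂ R (sym (toℕ-vertex i)) (sym (toℕ-vertex j))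
  vertex-step : ∀ (i : Fin l) → Graph.Adj G (vertex (inject₁ i)) (vertex (suc i))
  vertex-step i = R⇒Adj-vertex (subst (λ k → R (w k) (w (suc (toℕ i)))) (sym (toℕ-inject₁ i))
                                      (w-step (m<n⇒m<1+n (toℕ<n i))))
  vertex-close : Graph.Adj G (vertex (fromℕ l)) (vertex zero)
  vertex-close = R⇒Adj-vertex (subst₂ (λ k k′ → R (w k) k′) (sym (toℕ-fromℕ l)) closed (w-step (n<1+n l)))

-- Vertices 0 … B−1 are branch vertices; path e has d e internal vertices base e, …, base e + d e − 1.
module PathNumbering (B : ℕ) (d : ℕ → ℕ) where

  base : ℕ → ℕ
  base zero = B
  base (suc e) = base e + d e

  base-mono : ∀ {e e′} → e ≤ e′ → base e ≤ base e′
  base-mono {e′ = zero} z≤n = ≤-refl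
  base-mono {e} {suc e′} e≤1+e′ with m≤n⇒m<n∨m≡n e≤1+e′
  ... | inj₁ e<1+e′ = ≤-trans (base-mono (s≤s⁻¹ e<1+e′)) (m≤m+n _ _)
  ... | inj₂ refl = ≤-refl

  B≤internal : ∀ e p → B ≤ base e + p
  B≤internal e p = ≤-trans (base-mono {0} {e} z≤n) (m≤m+n (base e) p)

  branch≢internal : ∀ {x} e p → x < B → x ≢ base e + p
  branch≢internal e p x<B = <⇒≢ (<-≤-trans x<B (B≤internal e p))

  internal<base-suc : ∀ {e p} → p < d e → base e + p < base (suc e)
  internal<base-suc {e} p<d = +-monoʳ-< (base e) p<d

  internal<internal : ∀ {e e′ p} p′ → e < e′ → p < d e → base e + p < base e′ + p′
  internal<internal {e′ = e′} p′ e<e′ p<d =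
    <-≤-trans (internal<base-suc p<d) (≤-trans (base-mono e<e′) (m≤m+n (base e′) p′))

  internal-unique : ∀ e e′ {p p′} → p < d e → p′ < d e′ → base e + p ≡ base e′ + p′ → e ≡ e′ × p ≡ p′
  internal-unique e e′ {p} {p′} p<d p′<d eq with <-cmp e e′
  ... | tri< e<e′ _ _ = ⊥-elim (<⇒≢ (internal<internal p′ e<e′ p<d) eq)
  ... | tri> _ _ e′<e = ⊥-elim (<⇒≢ (internal<internal p e′<e p′<d) (sym eq))
  ... | tri≈ _ refl _ = refl , +-cancelˡ-≡ (base e) p p′ eq

  locate : ∀ m v → B ≤ v → v < base m → ∃ λ e → e < m × ∃ λ p → p < d e × v ≡ base e + p
  locate zero v B≤v v<B = ⊥-elim (<⇒≱ v<B B≤v)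
  locate (suc m) v B≤v v<base with v <? base m
  ... | yes v<base′ = let e , e<m , rest = locate m v B≤v v<base′ in e , m<n⇒m<1+n e<m , rest
  ... | no v≮base′ = m , n<1+n m , v ∸ base m ,
        subst (v ∸ base m <_) (m+n∸m≡n (base m) (d m)) (∸-monoˡ-< v<base base≤v) , sym (m+[n∸m]≡n base≤v)
    where base≤v = ≮⇒≥ v≮base′

-- The multigraph on branch vertices 0 … B−1 with edges e < E from src e to dst e, each subdivided into a
-- path with d e internal vertices.
module SubdividedGraph (B E : ℕ) (d src dst : ℕ → ℕ)
                       (src<B : ∀ e → e < E → src e < B) (dst<B : ∀ e → e < E → dst e < B)
                       (d>0 : ∀ e → e < E → 0 < d e) where

  open PathNumbering B d public

  data Step : ℕ → ℕ → Set where
    enter : ∀ {e} → e < E → Step (src e) (base e + 0)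
    along : ∀ {e p} → e < E → suc p < d e → Step (base e + p) (base e + suc p)
    leave : ∀ {e p} → e < E → suc p ≡ d e → Step (base e + p) (dst e)

  Adjacent : ℕ → ℕ → Set
  Adjacent u v = Step u v ⊎ Step v u

  Step⇒≢ : ∀ {u v} → Step u v → u ≢ v
  Step⇒≢ (enter {e} e<E) = branch≢internal e 0 (src<B e e<E)
  Step⇒≢ (along {e} {p} _ _) = <⇒≢ (+-monoʳ-< (base e) (n<1+n p))
  Step⇒≢ (leave {e} {p} e<E _) = ≢-sym (branch≢internal e p (dst<B e e<E))

  graph : Graph
  graph = record
    { n = base E
    ; Adj = λ u v → Adjacent (toℕ u) (toℕ v)
    ; sym = swap
    ; irrefl = λ { (inj₁ s) → Step⇒≢ s refl ; (inj₂ s) → Step⇒≢ s refl }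
    }

  prevOnPath : ℕ → ℕ → ℕ
  prevOnPath e zero = src e
  prevOnPath e (suc p) = base e + p

  nextOnPath : ℕ → ℕ → ℕ
  nextOnPath e p with suc p <? d e
  ... | yes _ = base e + suc p
  ... | no _ = dst e

  nextOnPath-along : ∀ {e p} → suc p < d e → nextOnPath e p ≡ base e + suc p
  nextOnPath-along {e} {p} p+1<d with suc p <? d e
  ... | yes _ = refl
  ... | no p+1≮d = ⊥-elim (p+1≮d p+1<d)

  nextOnPath-leave : ∀ {e p} → suc p ≡ d e → nextOnPath e p ≡ dst e
  nextOnPath-leave {e} {p} p+1≡d with suc p <? d e
  ... | yes p+1<d = ⊥-elim (<⇒≢ p+1<d p+1≡d)
  ... | no _ = refl

  internal-neighbour : ∀ {e p u w} → p < d e → u ≡ base e + p → Adjacent u w →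
                       w ≡ prevOnPath e p ⊎ w ≡ nextOnPath e p
  internal-neighbour {e} {p} p<d u≡ (inj₁ (enter {e′} e′<E)) = ⊥-elim (branch≢internal e p (src<B e′ e′<E) u≡)
  internal-neighbour {e} p<d u≡ (inj₁ (along {e′} _ p′+1<d))
    with internal-unique e′ e (<-trans (n<1+n _) p′+1<d) p<d u≡
  ... | refl , refl = inj₂ (sym (nextOnPath-along p′+1<d))
  internal-neighbour {e} p<d u≡ (inj₁ (leave {e′} _ p′+1≡d)) with internal-unique e′ e (≤-reflexive p′+1≡d) p<d u≡
  ... | refl , refl = inj₂ (sym (nextOnPath-leave p′+1≡d))
  internal-neighbour {e} p<d u≡ (inj₂ (enter {e′} e′<E)) with internal-unique e′ e (d>0 e′ e′<E) p<d u≡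
  ... | refl , refl = inj₁ refl
  internal-neighbour {e} p<d u≡ (inj₂ (along {e′} _ p′+1<d)) with internal-unique e′ e p′+1<d p<d u≡
  ... | refl , refl = inj₁ refl
  internal-neighbour {e} {p} p<d u≡ (inj₂ (leave {e′} e′<E _)) = ⊥-elim (branch≢internal e p (dst<B e′ e′<E) u≡)

  branch-neighbour : ∀ {u v} → u < B → Adjacent u v → B ≤ v
  branch-neighbour u<B (inj₁ (enter {e} _)) = B≤internal e 0
  branch-neighbour u<B (inj₁ (along {e} {p} _ _)) = ⊥-elim (branch≢internal e p u<B refl)
  branch-neighbour u<B (inj₁ (leave {e} {p} _ _)) = ⊥-elim (branch≢internal e p u<B refl)
  branch-neighbour u<B (inj₂ (enter {e} _)) = ⊥-elim (branch≢internal e 0 u<B refl)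
  branch-neighbour u<B (inj₂ (along {e} {p} _ _)) = ⊥-elim (branch≢internal e (suc p) u<B refl)
  branch-neighbour u<B (inj₂ (leave {e} {p} _ _)) = B≤internal e p

  Visits : Cycle graph → ℕ → Set
  Visits C x = ∃ λ i → toℕ (vert C i) ≡ x

  module _ (C : Cycle graph) where

    private
      value : Fin (len C) → ℕ
      value i = toℕ (vert C i)

      value-inj : Injective _≡_ _≡_ value
      value-inj = distinct C ∘ toℕ-injective

    visits-path-neighbours : ∀ {e p} → p < d e → Visits C (base e + p) →
                             Visits C (prevOnPath e p) × Visits C (nextOnPath e p)
    visits-path-neighbours p<d (i , vi) with two-neighbours C i
    ... | j , j′ , j≢j′ , adj , adj′ = both (internal-neighbour p<d vi adj) (internal-neighbour p<d vi adj′)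
      where
      j≠j′ : value j ≢ value j′
      j≠j′ = j≢j′ ∘ value-inj
      both : _ → _ → Visits C _ × Visits C _
      both (inj₁ j-prev) (inj₁ j′-prev) = ⊥-elim (j≠j′ (trans j-prev (sym j′-prev)))
      both (inj₁ j-prev) (inj₂ j′-next) = (j , j-prev) , (j′ , j′-next)
      both (inj₂ j-next) (inj₁ j′-prev) = (j′ , j′-prev) , (j , j-next)
      both (inj₂ j-next) (inj₂ j′-next) = ⊥-elim (j≠j′ (trans j-next (sym j′-next)))

    visits-path-start : ∀ {e} p → p < d e → Visits C (base e + p) → Visits C (base e + 0)
    visits-path-start zero _ v = v
    visits-path-start (suc p) p+1<d v =
      visits-path-start p (<-trans (n<1+n p) p+1<d) (proj₁ (visits-path-neighbours p+1<d v))

    visits-path-from-start : ∀ {e} → Visits C (base e + 0) → ∀ p → p < d e → Visits C (base e + p)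
    visits-path-from-start v zero _ = v
    visits-path-from-start v (suc p) p+1<d = subst (Visits C) (nextOnPath-along p+1<d)
      (proj₂ (visits-path-neighbours p<d (visits-path-from-start v p p<d)))
      where p<d = <-trans (n<1+n p) p+1<d

    visits-path : ∀ {e p} → p < d e → Visits C (base e + p) → ∀ p′ → p′ < d e → Visits C (base e + p′)
    visits-path {p = p} p<d v = visits-path-from-start (visits-path-start p p<d v)

    visits-src : ∀ {e p} → e < E → p < d e → Visits C (base e + p) → Visits C (src e)
    visits-src {e} {p} e<E p<d v = proj₁ (visits-path-neighbours (d>0 e e<E) (visits-path-start p p<d v))

    meets-or-misses-path : ∀ e → (∃ λ p → p < d e × Visits C (base e + p)) ⊎
                                 (∀ i → toℕ (vert C i) < base e ⊎ base e + d e ≤ toℕ (vert C i))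
    meets-or-misses-path e with any? (λ i → (base e ≤? value i) ×-dec (value i <? base e + d e))
    ... | yes (i , base≤v , v<end) =
      inj₁ (value i ∸ base e , subst (value i ∸ base e <_) (m+n∸m≡n (base e) (d e)) (∸-monoˡ-< v<end base≤v) ,
            i , sym (m+[n∸m]≡n base≤v))
    ... | no misses = inj₂ λ i → case-on i
      where
      case-on : ∀ i → value i < base e ⊎ base e + d e ≤ value i
      case-on i with value i <? base e | base e + d e ≤? value i
      ... | yes v<base | _ = inj₁ v<base
      ... | no _ | yes end≤v = inj₂ end≤v
      ... | no v≮base | no end≰v = ⊥-elim (misses (i , ≮⇒≥ v≮base , ≰⇒> end≰v))

    highest-path : ∃ λ e → e < E × (∃ λ p → p < d e × Visits C (base e + p)) × (∀ i → toℕ (vert C i) < base (suc e))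
    highest-path with argmax value
    ... | i , max with B ≤? value i | two-neighbours C i
    ... | no v≱B | j , _ , _ , adj , _ =
      ⊥-elim (<⇒≱ (<-≤-trans (≰⇒> v≱B) (branch-neighbour (≰⇒> v≱B) adj)) (max j))
    ... | yes B≤v | _ with locate E (value i) B≤v (toℕ<n (vert C i))
    ... | e , e<E , p , p<d , v≡ = e , e<E , (p , p<d , i , v≡) ,
          λ j → ≤-<-trans (max j) (subst (_< base (suc e)) (sym v≡) (internal<base-suc p<d))

    len≤ : ∀ P → (∀ i → toℕ (vert C i) < P) → len C ≤ P
    len≤ P v<P = bounded-injection⇒≤ P value v<P value-inj

    len+gap≤ : ∀ P Q c → (∀ i → toℕ (vert C i) < P) → (∀ i → toℕ (vert C i) < Q ⊎ Q + c ≤ toℕ (vert C i)) →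
               Q + c ≤ P → len C + c ≤ P
    len+gap≤ P Q c v<P v∉gap Q+c≤P = gapped-injection⇒≤ P Q c value v<P value-inj v∉gap Q+c≤P

    path≤len : ∀ {e p} → p < d e → Visits C (base e + p) → d e ≤ len C
    path≤len {e} p<d v = covering⇒≤ (base e) (d e) value (visits-path p<d v)

  -- walk e q z lists src e, the path e, src (e + 1), the path e + 1, …, the path e + q − 1, and then z.
  walk : ℕ → ℕ → ℕ → ℕ → ℕ
  walk e zero    z i = z
  walk e (suc q) z zero = src e
  walk e (suc q) z (suc i) with i <? d e
  ... | yes _ = base e + i
  ... | no _ = walk (suc e) q z (i ∸ d e)

  walkLength : ℕ → ℕ → ℕ
  walkLength e zero = 0
  walkLength e (suc q) = suc (d e + walkLength (suc e) q)

  walk-on-path : ∀ {e q z p} → p < d e → walk e (suc q) z (suc p) ≡ base e + p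
  walk-on-path {e} {p = p} p<d with p <? d e
  ... | yes _ = refl
  ... | no p≮d = ⊥-elim (p≮d p<d)

  walk-in-tail : ∀ {e q z} j → walk e (suc q) z (suc (d e + j)) ≡ walk (suc e) q z j
  walk-in-tail {e} {q} {z} j with d e + j <? d e
  ... | yes d+j<d = ⊥-elim (<⇒≱ d+j<d (m≤m+n (d e) j))
  ... | no _ = cong (walk (suc e) q z) (m+n∸m≡n (d e) j)

  data Position (e q : ℕ) : ℕ → Set where
    at-src  : Position e q 0
    on-path : ∀ {p} → p < d e → Position e q (suc p)
    in-tail : ∀ {j} → j < walkLength (suc e) q → Position e q (suc (d e + j))

  position : ∀ {e q i} → i < walkLength e (suc q) → Position e q i
  position {i = zero} _ = at-src
  position {e} {q} {suc i} i<len with i <? d e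
  ... | yes i<d = on-path i<d
  ... | no i≮d = subst (Position e q ∘ suc) (m+[n∸m]≡n d≤i) (in-tail tail-bound)
    where
    d≤i = ≮⇒≥ i≮d
    tail-bound : i ∸ d e < walkLength (suc e) q
    tail-bound = subst (i ∸ d e <_) (m+n∸m≡n (d e) _) (∸-monoˡ-< (s≤s⁻¹ i<len) d≤i)

  walk-closes : ∀ e q z → walk e q z (walkLength e q) ≡ z
  walk-closes e zero z = refl
  walk-closes e (suc q) z = trans (walk-in-tail (walkLength (suc e) q)) (walk-closes (suc e) q z)

  walkLength-base : ∀ e q → walkLength e q + base e ≡ q + base (e + q)
  walkLength-base e zero = cong base (sym (+-identityʳ e))
  walkLength-base e (suc q) = cong suc (begin
    d e + walkLength (suc e) q + base e    ≡⟨ regroup ⟩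
    walkLength (suc e) q + base (suc e)    ≡⟨ walkLength-base (suc e) q ⟩
    q + base (suc e + q)                   ≡⟨ cong (λ a → q + base a) (sym (+-suc e q)) ⟩
    q + base (e + suc q)                   ∎)
    where
    open ≡-Reasoning
    open +-*-Solver
    regroup : d e + walkLength (suc e) q + base e ≡ walkLength (suc e) q + (base e + d e)
    regroup =
      solve 3 (λ x y z → (x :+ y) :+ z := y :+ (z :+ x)) refl (d e) (walkLength (suc e) q) (base e)

  OnWalk : ℕ → ℕ → ℕ → Set
  OnWalk e q x = ∃ λ a → e ≤ a × a < e + q × (x ≡ src a ⊎ ∃ λ p → p < d a × x ≡ base a + p)

  OnWalk-tail : ∀ {e q x} → OnWalk (suc e) q x → OnWalk e (suc q) x
  OnWalk-tail {e} {q} (a , e<a , a< , x≡) = a , <⇒≤ e<a , subst (a <_) (sym (+-suc e q)) a< , x≡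

  walk-on : ∀ {e q z i} → i < walkLength e q → OnWalk e q (walk e q z i)
  walk-on {e} {suc q} i< with position i<
  ... | at-src = e , ≤-refl , m<m+n e z<s , inj₁ refl
  ... | on-path {p} p<d = e , ≤-refl , m<m+n e z<s , inj₂ (p , p<d , walk-on-path p<d)
  ... | in-tail {j} j< = subst (OnWalk e (suc q)) (sym (walk-in-tail j)) (OnWalk-tail (walk-on j<))

  -- walk (suc e) q z 0 is src (suc e), or z when e is the last path.
  Chain : ℕ → ℕ → ℕ → Set
  Chain e zero    z = ⊤
  Chain e (suc q) z = e < E × dst e ≡ walk (suc e) q z 0 × (∀ {a} → e < a → a ≤ e + q → src a ≢ src e) ×
                      Chain (suc e) q z

  chain-within : ∀ {e q z a} → Chain e q z → e ≤ a → a < e + q → a < E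
  chain-within {e} {zero} _ e≤a a<e+0 = ⊥-elim (<⇒≱ a<e+0 (subst (_≤ _) (sym (+-identityʳ e)) e≤a))
  chain-within {e} {suc q} {a = a} (e<E , _ , _ , chain) e≤a a< with m≤n⇒m<n∨m≡n e≤a
  ... | inj₂ refl = e<E
  ... | inj₁ e<a = chain-within chain e<a (subst (a <_) (+-suc e q) a<)

  walk<base-E : ∀ {e q z i} → Chain e q z → i < walkLength e q → walk e q z i < base E
  walk<base-E {e} {suc q} (e<E , _ , _ , chain) i< with position i<
  ... | at-src = <-≤-trans (src<B e e<E) (base-mono {0} {E} z≤n)
  ... | on-path p<d = subst (_< base E) (sym (walk-on-path p<d)) (<-≤-trans (internal<base-suc p<d) (base-mono e<E))
  ... | in-tail {j} j< = subst (_< base E) (sym (walk-in-tail j)) (walk<base-E chain j<)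

  src∉walk-tail : ∀ {e q z j} → Chain e (suc q) z → j < walkLength (suc e) q → src e ≢ walk (suc e) q z j
  src∉walk-tail {e} (e<E , _ , fresh , _) j< src≡ with walk-on j<
  ... | a , e<a , a< , inj₁ w≡src = fresh e<a (s≤s⁻¹ a<) (sym (trans src≡ w≡src))
  ... | a , _ , _ , inj₂ (p , _ , w≡int) = branch≢internal a p (src<B e e<E) (trans src≡ w≡int)

  path∉walk-tail : ∀ {e q z p j} → Chain e (suc q) z → p < d e → j < walkLength (suc e) q →
                   base e + p ≢ walk (suc e) q z j
  path∉walk-tail {e} {p = p} (_ , _ , _ , chain) p<d j< int≡ with walk-on j<
  ... | a , e<a , a< , inj₁ w≡src =
    branch≢internal e p (src<B a (chain-within chain e<a a<)) (sym (trans int≡ w≡src))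
  ... | a , e<a , _ , inj₂ (p′ , p′<d , w≡int) =
    <⇒≢ e<a (proj₁ (internal-unique e a p<d p′<d (trans int≡ w≡int)))

  walk-injective : ∀ {e q z} → Chain e q z → ∀ {i j} → i < walkLength e q → j < walkLength e q →
                   walk e q z i ≡ walk e q z j → i ≡ j
  walk-injective {e} {suc q} {z} chain@(e<E , _ , _ , chain′) i< j< eq with position i< | position j<
  ... | at-src | at-src = refl
  ... | at-src | on-path {p} p<d =
    ⊥-elim (branch≢internal e p (src<B e e<E) (trans eq (walk-on-path p<d)))
  ... | on-path {p} p<d | at-src =
    ⊥-elim (branch≢internal e p (src<B e e<E) (trans (sym eq) (walk-on-path p<d)))
  ... | at-src | in-tail {j} j< = ⊥-elim (src∉walk-tail chain j< (trans eq (walk-in-tail j)))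
  ... | in-tail {j} j< | at-src = ⊥-elim (src∉walk-tail chain j< (trans (sym eq) (walk-in-tail j)))
  ... | on-path {p} p<d | on-path {p′} p′<d =
    cong suc (+-cancelˡ-≡ (base e) p p′ (trans (sym (walk-on-path p<d)) (trans eq (walk-on-path p′<d))))
  ... | on-path {p} p<d | in-tail {j} j< =
    ⊥-elim (path∉walk-tail chain p<d j< (trans (sym (walk-on-path p<d)) (trans eq (walk-in-tail j))))
  ... | in-tail {j} j< | on-path {p} p<d =
    ⊥-elim (path∉walk-tail chain p<d j< (trans (sym (walk-on-path p<d)) (trans (sym eq) (walk-in-tail j))))
  ... | in-tail {j} j< | in-tail {j′} j′< =
    cong (λ k → suc (d e + k))
         (walk-injective chain′ j< j′< (trans (sym (walk-in-tail j)) (trans eq (walk-in-tail j′))))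

  walk-step : ∀ {e q z} → Chain e q z → ∀ {i} → i < walkLength e q → Adjacent (walk e q z i) (walk e q z (suc i))
  walk-step {e} {suc q} {z} (e<E , linked , _ , chain) i< with position i<
  ... | at-src = inj₁ (subst (Step (src e)) (sym (walk-on-path (d>0 e e<E))) (enter e<E))
  ... | in-tail {j} j< = subst₂ Adjacent (sym (walk-in-tail j)) (sym next≡) (walk-step chain j<)
    where
    next≡ : walk e (suc q) z (suc (suc (d e + j))) ≡ walk (suc e) q z (suc j)
    next≡ = trans (cong (walk e (suc q) z ∘ suc) (sym (+-suc (d e) j))) (walk-in-tail (suc j))
  ... | on-path {p} p<d with m≤n⇒m<n∨m≡n p<d
  ...   | inj₁ p+1<d = inj₁ (subst₂ Step (sym (walk-on-path p<d)) (sym (walk-on-path p+1<d)) (along e<E p+1<d))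
  ...   | inj₂ p+1≡d = inj₁ (subst₂ Step (sym (walk-on-path p<d)) (sym next≡) (leave e<E p+1≡d))
    where
    next≡ : walk e (suc q) z (suc (suc p)) ≡ dst e
    next≡ = trans (cong (walk e (suc q) z ∘ suc) (trans p+1≡d (sym (+-identityʳ (d e)))))
                  (trans (walk-in-tail 0) (sym linked))

  chainCycle : ∀ {e q} → Chain e (suc (suc q)) (src e) →
               Σ (Cycle graph) λ C → len C ≡ walkLength e (suc (suc q)) ×
                                     (∀ i → OnWalk e (suc (suc q)) (toℕ (vert C i)))
  chainCycle {e} {q} chain@(e<E , _) =
    let C , len≡ , vert≡ = cycleFromClosedWalk graph (walkLength e Q) (walk e Q (src e))
                             (walk<base-E chain) (walk-injective chain) Adjacent (λ adj → adj) (walk-step chain)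
                             (walk-closes e Q (src e)) (s≤s (+-mono-≤ (d>0 e e<E) (s≤s z≤n)))
    in C , len≡ , λ i → subst (OnWalk e Q) (sym (vert≡ i)) (walk-on (subst (toℕ i <_) len≡ (toℕ<n i)))
    where Q = suc (suc q)

module Digits (r : ℕ) .{{_ : NonZero r}} where

  high-digit : ∀ a {b} → b < r → (a * r + b) / r ≡ a
  high-digit a {b} b<r = begin
    (a * r + b) / r      ≡⟨ +-distrib-/-∣ˡ b (divides-refl a) ⟩
    a * r / r + b / r    ≡⟨ cong₂ _+_ (m*n/n≡m a r) (m<n⇒m/n≡0 b<r) ⟩
    a + 0                ≡⟨ +-identityʳ a ⟩
    a                    ∎
    where open ≡-Reasoning

  low-digit : ∀ a {b} → b < r → (a * r + b) % r ≡ b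
  low-digit a {b} b<r = begin
    (a * r + b) % r      ≡⟨ cong (_% r) (+-comm (a * r) b) ⟩
    (b + a * r) % r      ≡⟨ [m+kn]%n≡m%n b a r ⟩
    b % r                ≡⟨ m<n⇒m%n≡m b<r ⟩
    b                    ∎
    where open ≡-Reasoning

  digits-unique : ∀ a a′ {b b′} → b < r → b′ < r → a * r + b ≡ a′ * r + b′ → a ≡ a′ × b ≡ b′
  digits-unique a a′ b<r b′<r eq =
    trans (sym (high-digit a b<r)) (trans (cong (_/ r) eq) (high-digit a′ b′<r)) ,
    trans (sym (low-digit a b<r)) (trans (cong (_% r) eq) (low-digit a′ b′<r))

  two-digit< : ∀ {a b} → a < r → b < r → a * r + b < r * r
  two-digit< {a} a<r b<r =
    <-≤-trans (+-monoʳ-< (a * r) b<r) (≤-trans (≤-reflexive (+-comm (a * r) r)) (*-monoˡ-≤ r a<r))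

  -- An unordered pair {k, s} of digits, written as the two-digit number (min, max).
  pair : ℕ → ℕ → ℕ
  pair k s = (k ⊓ s) * r + (k ⊔ s)

  pair-comm : ∀ k s → pair k s ≡ pair s k
  pair-comm k s = cong₂ (λ a b → a * r + b) (⊓-comm k s) (⊔-comm k s)

  pair< : ∀ {k s} → k < r → s < r → pair k s < r * r
  pair< {k} {s} k<r s<r = two-digit< (≤-<-trans (m⊓n≤m k s) k<r) (⊔-lub k<r s<r)

  pair-digits : ∀ {k s k′ s′} → k < r → s < r → k′ < r → s′ < r → pair k s ≡ pair k′ s′ →
                k ⊓ s ≡ k′ ⊓ s′ × k ⊔ s ≡ k′ ⊔ s′
  pair-digits k<r s<r k′<r s′<r = digits-unique _ _ (⊔-lub k<r s<r) (⊔-lub k′<r s′<r)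

  pair-injectiveʳ : ∀ {k s s′} → k < r → s < r → s′ < r → pair k s ≡ pair k s′ → s ≡ s′
  pair-injectiveʳ {k} {s} {s′} k<r s<r s′<r eq with pair-digits k<r s<r k<r s′<r eq
  ... | min≡ , max≡ = +-cancelˡ-≡ k s s′ (trans (sym (⊓+⊔ k s)) (trans (cong₂ _+_ min≡ max≡) (⊓+⊔ k s′)))

  -- Whether k is the smaller (0) or the larger (1) member of the pair coded by x.
  side : ℕ → ℕ → Fin 2
  side k x with k ≟ x / r
  ... | yes _ = zero
  ... | no _ = suc zero

  side-separates : ∀ {k s k′ s′} → k < r → s < r → k′ < r → s′ < r → pair k s ≡ pair k′ s′ →
                   side k (pair k s) ≡ side k′ (pair k s) → k ≡ k′
  side-separates {k} {s} {k′} {s′} k<r s<r k′<r s′<r eq same with k ≟ pair k s / r | k′ ≟ pair k s / r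
  ... | yes k≡ | yes k′≡ = trans k≡ (sym k′≡)
  ... | yes _  | no _    = case same of λ ()
  ... | no _   | yes _   = case same of λ ()
  ... | no k≢  | no k′≢  = trans (sym (larger k≢min)) (trans (proj₂ digits) (larger k′≢min))
    where
    digits = pair-digits k<r s<r k′<r s′<r eq
    min-digit : pair k s / r ≡ k ⊓ s
    min-digit = high-digit (k ⊓ s) (⊔-lub k<r s<r)
    k≢min : k ≢ k ⊓ s
    k≢min k≡ = k≢ (trans k≡ (sym min-digit))
    k′≢min : k′ ≢ k′ ⊓ s′
    k′≢min k′≡ = k′≢ (trans k′≡ (sym (trans min-digit (proj₁ digits))))
    larger : ∀ {m n} → m ≢ m ⊓ n → m ⊔ n ≡ m
    larger {m} {n} m≢m⊓n with ≤-total m n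
    ... | inj₁ m≤n = ⊥-elim (m≢m⊓n (sym (m≤n⇒m⊓n≡m m≤n)))
    ... | inj₂ n≤m = m≥n⇒m⊔n≡m n≤m

record FirstFrom (L : ℕ → Set) (x c : ℕ) : Set where
  constructor firstFrom
  field
    below : ∀ i → i < c → ¬ L (x + i)
    hit   : L (x + c)

module _ {L : ℕ → Set} where

  open RawMonad (¬¬-Monad {0ℓ}) using (_>>=_; return; _<$>_)

  FirstFrom⇒≤ : ∀ {x c m} → FirstFrom L x c → x ≤ m → L m → x + c ≤ m
  FirstFrom⇒≤ {x} {c} {m} (firstFrom below _) x≤m Lm with x + c ≤? m
  ... | yes x+c≤m = x+c≤m
  ... | no x+c≰m = ⊥-elim (below (m ∸ x) m-x<c (subst L (sym (m+[n∸m]≡n x≤m)) Lm))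
    where
    m-x<c : m ∸ x < c
    m-x<c = subst (m ∸ x <_) (m+n∸m≡n x c) (∸-monoˡ-< (≰⇒> x+c≰m) x≤m)

  FirstFrom-drop : ∀ {x} j {c} → FirstFrom L x (j + c) → FirstFrom L (x + j) c
  FirstFrom-drop {x} j (firstFrom below hit) = firstFrom
    (λ i i<c → subst (¬_ ∘ L) (sym (+-assoc x j i)) (below (j + i) (+-monoʳ-< j i<c)))
    (subst L (sym (+-assoc x j _)) hit)

  FirstFrom-suc : ∀ {x c} → ¬ L x → FirstFrom L (suc x) c → FirstFrom L x (suc c)
  FirstFrom-suc {x} ¬Lx (firstFrom below hit) = firstFrom below′ (subst L (sym (+-suc x _)) hit)
    where
    below′ : ∀ i → i < suc _ → ¬ L (x + i)
    below′ zero _ = subst (¬_ ∘ L) (sym (+-identityʳ x)) ¬Lx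
    below′ (suc i) i<c = subst (¬_ ∘ L) (sym (+-suc x i)) (below i (s≤s⁻¹ i<c))

  ¬¬firstFrom : ∀ x m → L (x + m) → ¬ ¬ ∃ (FirstFrom L x)
  ¬¬firstFrom x zero Lx = return (0 , firstFrom (λ _ ()) Lx)
  ¬¬firstFrom x (suc m) L[x+m+1] = ¬¬-excluded-middle >>= λ where
    (yes Lx) → return (0 , firstFrom (λ _ ()) (subst L (sym (+-identityʳ x)) Lx))
    (no ¬Lx) → (λ (c , first) → suc c , FirstFrom-suc ¬Lx first) <$>
                 ¬¬firstFrom (suc x) m (subst L (+-suc x m) L[x+m+1])

  -- An element ℓ ≥ b of L cannot lie in a porous window of length ℓ + c starting at a ≥ 1, so a > ℓ; the
  -- first element of L from a is then at least a + c.
  ¬¬firstFrom-above : Infinite L → Porous L → ∀ b c → ¬ ¬ ∃ λ x → b < x × FirstFrom L x c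
  ¬¬firstFrom-above infinite porous b c = do
    let ℓ , b≤ℓ , Lℓ = infinite b
        a , 1≤a , free = porous (ℓ + c)
        m , a≤m , Lm = infinite a
    c′ , first ← ¬¬firstFrom a (m ∸ a) (subst L (sym (m+[n∸m]≡n a≤m)) Lm)
    let c≤c′ = window≤ free first
    return (a + (c′ ∸ c) , <-≤-trans (≤-<-trans b≤ℓ (ℓ<a 1≤a free Lℓ)) (m≤m+n a _) ,
            FirstFrom-drop (c′ ∸ c) (subst (FirstFrom L a) (sym (m∸n+n≡m c≤c′)) first))
    where
    ℓ<a : ∀ {ℓ a} → 1 ≤ a → (∀ i → i < ℓ + c → ¬ L (a + i)) → L ℓ → ℓ < a
    ℓ<a {ℓ} {a} 1≤a free Lℓ with ℓ <? a
    ... | yes ℓ<a = ℓ<a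
    ... | no ℓ≮a = ⊥-elim (free (ℓ ∸ a) (<-≤-trans (∸-monoʳ-< 1≤a a≤ℓ) (m≤m+n ℓ c))
                                (subst L (sym (m+[n∸m]≡n a≤ℓ)) Lℓ))
      where a≤ℓ = ≮⇒≥ ℓ≮a
    window≤ : ∀ {ℓ a c′} → (∀ i → i < ℓ + c → ¬ L (a + i)) → FirstFrom L a c′ → c ≤ c′
    window≤ {ℓ} {c′ = c′} free (firstFrom _ La+c′) with c ≤? c′
    ... | yes c≤c′ = c≤c′
    ... | no c≰c′ = ⊥-elim (free c′ (<-≤-trans (≰⇒> c≰c′) (m≤n+m c ℓ)) La+c′)

module Counterexample (L : ℕ → Set) (t : ℕ) where

  r : ℕ
  r = 2 + 3 * t

  open Digits r

  B E : ℕ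
  B = r * r
  E = r * r

  -- Path k * r + s (k, s < r) joins the branch vertices {k, s} and {k, s + 1 mod r}, so that for each k
  -- the paths k * r, …, k * r + r − 1 form the block cycle through all pairs containing k.
  src dst : ℕ → ℕ
  src e = pair (e / r) (e % r)
  dst e = pair (e / r) (suc (e % r) % r)

  src<B : ∀ e → e < E → src e < B
  src<B e e<E = pair< (m<n*o⇒m/o<n e<E) (m%n<n e r)

  dst<B : ∀ e → e < E → dst e < B
  dst<B e e<E = pair< (m<n*o⇒m/o<n e<E) (m%n<n (suc (e % r)) r)

  module Numbering (d : ℕ → ℕ) = PathNumbering B d
  open Numbering using (base)

  -- A cycle whose highest path is e has between d e and base e + d e vertices.  For most e no such length
  -- may lie in L; for the last path of block k the first element of L is the length of the block cycle k.
  gapAfter : (ℕ → ℕ) → ℕ → ℕ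
  gapAfter d e with suc (e % r) ≟ r
  ... | yes _ = r + (base d e ∸ base d (e / r * r))
  ... | no _ = suc (base d e)

  gapAfter-last : ∀ d {e} → suc (e % r) ≡ r → gapAfter d e ≡ r + (base d e ∸ base d (e / r * r))
  gapAfter-last d {e} last with suc (e % r) ≟ r
  ... | yes _ = refl
  ... | no not-last = ⊥-elim (not-last last)

  gapAfter-inner : ∀ d {e} → suc (e % r) ≢ r → gapAfter d e ≡ suc (base d e)
  gapAfter-inner d {e} not-last with suc (e % r) ≟ r
  ... | yes last = ⊥-elim (not-last last)
  ... | no _ = refl

  Admissible : (ℕ → ℕ) → ℕ → ℕ → Set
  Admissible d e x = base d e < x × FirstFrom L x (gapAfter d e)

  path<E : ∀ {k s} → k < r → s < r → k * r + s < E
  path<E = two-digit<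

  block-decompose : ∀ {k a} → k * r ≤ a → a < k * r + r → ∃ λ s → s < r × a ≡ k * r + s
  block-decompose {k} {a} kr≤a a<kr+r =
    a ∸ k * r , subst (a ∸ k * r <_) (m+n∸m≡n (k * r) r) (∸-monoˡ-< a<kr+r kr≤a) , sym (m+[n∸m]≡n kr≤a)

  src-path : ∀ k {s} → s < r → src (k * r + s) ≡ pair k s
  src-path k s<r = cong₂ pair (high-digit k s<r) (low-digit k s<r)

  dst-path : ∀ k {s} → s < r → dst (k * r + s) ≡ pair k (suc s % r)
  dst-path k s<r = cong₂ (λ a b → pair a (suc b % r)) (high-digit k s<r) (low-digit k s<r)

  module WithPathLengths (d : ℕ → ℕ) (admissible : ∀ e → e < E → Admissible d e (d e)) where

    d>0 : ∀ e → e < E → 0 < d e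
    d>0 e e<E = ≤-<-trans z≤n (proj₁ (admissible e e<E))

    open SubdividedGraph B E d src dst src<B dst<B d>0 public hiding (base)

    private
      digit< : ∀ {s q} → s + suc q ≡ r → s < r
      digit< {s} {q} s+q+1≡r = subst (s <_) s+q+1≡r (m<m+n s z<s)

      next-digit : ∀ {s q} → s + suc q ≡ r → suc s + q ≡ r
      next-digit {s} {q} s+q+1≡r = trans (sym (+-suc s q)) s+q+1≡r

      within-block : ∀ {k s q a} → s + suc q ≡ r → a ≤ k * r + s + q → a < k * r + r
      within-block {k} {s} {q} s+q+1≡r a≤ = <-≤-trans (s≤s a≤) (≤-reflexive (begin
        suc (k * r + s + q)    ≡⟨ +-suc (k * r + s) q ⟨
        k * r + s + suc q      ≡⟨ +-assoc (k * r) s (suc q) ⟩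
        k * r + (s + suc q)    ≡⟨ cong (k * r +_) s+q+1≡r ⟩
        k * r + r              ∎))
        where open ≡-Reasoning

    block-linked : ∀ k s q → s + suc q ≡ r → dst (k * r + s) ≡ walk (suc (k * r + s)) q (pair k 0) 0
    block-linked k s zero s+1≡r = trans (dst-path k (digit< s+1≡r)) (cong (pair k) (begin
      suc s % r   ≡⟨ cong (_% r) (trans (+-comm 1 s) s+1≡r) ⟩
      r % r       ≡⟨ n%n≡0 r ⟩
      0           ∎))
      where open ≡-Reasoning
    block-linked k s (suc q) s+q+2≡r = begin
      dst (k * r + s)             ≡⟨ dst-path k (digit< s+q+2≡r) ⟩
      pair k (suc s % r)          ≡⟨ cong (pair k) (m<n⇒m%n≡m s+1<r) ⟩
      pair k (suc s)              ≡⟨ src-path k s+1<r ⟨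
      src (k * r + suc s)         ≡⟨ cong src (+-suc (k * r) s) ⟩
      src (suc (k * r + s))       ∎
      where
      open ≡-Reasoning
      s+1<r = digit< (next-digit s+q+2≡r)

    block-fresh : ∀ {k} → k < r → ∀ s q → s + suc q ≡ r → ∀ {a} → k * r + s < a → a ≤ k * r + s + q →
                  src a ≢ src (k * r + s)
    block-fresh {k} k<r s q s+q+1≡r {a} kr+s<a a≤ src≡
      with block-decompose {k} (≤-trans (m≤m+n (k * r) s) (<⇒≤ kr+s<a)) (within-block {k} s+q+1≡r a≤)
    ... | s′ , s′<r , refl = <⇒≢ kr+s<a (cong (k * r +_) (sym s′≡s))
      where
      s′≡s = pair-injectiveʳ k<r s′<r (digit< s+q+1≡r)
               (trans (sym (src-path k s′<r)) (trans src≡ (src-path k (digit< s+q+1≡r))))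

    blockChain : ∀ {k} → k < r → ∀ s q → s + q ≡ r → Chain (k * r + s) q (pair k 0)
    blockChain k<r s zero _ = tt
    blockChain {k} k<r s (suc q) s+q+1≡r =
      path<E k<r (digit< s+q+1≡r) , block-linked k s q s+q+1≡r , block-fresh k<r s q s+q+1≡r ,
      subst (λ e → Chain e q (pair k 0)) (+-suc (k * r) s) (blockChain k<r (suc s) q (next-digit s+q+1≡r))

    blockLength : ℕ → ℕ
    blockLength k = walkLength (k * r) r

    BlockCycle : ℕ → Set
    BlockCycle k = Σ (Cycle graph) λ C → len C ≡ blockLength k × (∀ i → OnWalk (k * r) r (toℕ (vert C i)))

    blockCycle : ∀ {k} → k < r → BlockCycle k
    blockCycle {k} k<r =
      chainCycle (subst₂ (λ e z → Chain e r z) (+-identityʳ (k * r)) src≡ (blockChain k<r 0 r refl))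
      where
      src≡ : pair k 0 ≡ src (k * r)
      src≡ = trans (sym (src-path k z<s)) (cong src (+-identityʳ (k * r)))

    lastPath : ℕ → ℕ
    lastPath k = k * r + suc (3 * t)

    lastPath<E : ∀ {k} → k < r → lastPath k < E
    lastPath<E k<r = path<E k<r ≤-refl

    blockLength-base : ∀ k → blockLength k + base d (k * r) ≡ r + (base d (lastPath k) + d (lastPath k))
    blockLength-base k = trans (walkLength-base (k * r) r) (cong (λ e → r + base d e) (+-suc (k * r) (suc (3 * t))))

    blockLength-lastPath : ∀ k → blockLength k ≡ d (lastPath k) + gapAfter d (lastPath k)
    blockLength-lastPath k =
      trans (cancel (base-mono {k * r} (m≤m+n (k * r) _)) (blockLength-base k)) (cong (d e +_) (sym gap≡))
      where
      e = lastPath k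
      gap≡ : gapAfter d e ≡ r + (base d e ∸ base d (k * r))
      gap≡ = trans (gapAfter-last d {e} (cong suc (low-digit k ≤-refl)))
                   (cong (λ a → r + (base d e ∸ base d (a * r))) (high-digit k ≤-refl))
      open +-*-Solver
      cancel : ∀ {ℓ Y X D} → Y ≤ X → ℓ + Y ≡ r + (X + D) → ℓ ≡ D + (r + (X ∸ Y))
      cancel {ℓ} {Y} {X} {D} Y≤X eq = +-cancelʳ-≡ Y ℓ _ (begin
        ℓ + Y                    ≡⟨ eq ⟩
        r + (X + D)              ≡⟨ cong (λ x → r + (x + D)) (m∸n+n≡m Y≤X) ⟨
        r + (X ∸ Y + Y + D)      ≡⟨ solve 4 (λ r z y d → r :+ (z :+ y :+ d) := d :+ (r :+ z) :+ y)
                                           refl r (X ∸ Y) Y D ⟩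
        D + (r + (X ∸ Y)) + Y    ∎)
        where open ≡-Reasoning

    L-blockLength : ∀ {k} → k < r → L (blockLength k)
    L-blockLength {k} k<r =
      subst L (sym (blockLength-lastPath k)) (FirstFrom.hit (proj₂ (admissible _ (lastPath<E k<r))))

    blockLength≤ : ∀ k → blockLength k ≤ base d (k * r + r)
    blockLength≤ k = +-cancelʳ-≤ r _ _ (begin
      blockLength k + r              ≤⟨ +-monoʳ-≤ (blockLength k) r≤base ⟩
      blockLength k + base d (k * r) ≡⟨ walkLength-base (k * r) r ⟩
      r + base d (k * r + r)         ≡⟨ +-comm r _ ⟩
      base d (k * r + r) + r         ∎)
      where
      open ≤-Reasoning
      r≤base : r ≤ base d (k * r)
      r≤base = ≤-trans (m≤m*n r r) (base-mono {0} {k * r} z≤n)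

    base<blockLength : ∀ {k} → k < r → base d (lastPath k) < blockLength k
    base<blockLength {k} k<r = <-≤-trans (proj₁ (admissible _ (lastPath<E k<r)))
                                          (≤-trans (m≤m+n _ _) (≤-reflexive (sym (blockLength-lastPath k))))

    blockLength-increasing : ∀ {k k′} → k < k′ → k′ < r → blockLength k < blockLength k′
    blockLength-increasing {k} {k′} k<k′ k′<r =
      ≤-<-trans (blockLength≤ k) (≤-<-trans (base-mono end≤) (base<blockLength k′<r))
      where
      end≤ : k * r + r ≤ lastPath k′
      end≤ = ≤-trans (≤-reflexive (+-comm (k * r) r)) (≤-trans (*-monoˡ-≤ r k<k′) (m≤m+n (k′ * r) _))

    blockLength-injective : ∀ {k k′} → k < r → k′ < r → blockLength k ≡ blockLength k′ → k ≡ k′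
    blockLength-injective {k} {k′} k<r k′<r eq with <-cmp k k′
    ... | tri≈ _ k≡k′ _ = k≡k′
    ... | tri< k<k′ _ _ = ⊥-elim (<⇒≢ (blockLength-increasing k<k′ k′<r) eq)
    ... | tri> _ _ k′<k = ⊥-elim (<⇒≢ (blockLength-increasing k′<k k<r) (sym eq))

    private
      window-overflow : ∀ {ℓ Y X D A} → Y ≤ X → D + (r + (X ∸ Y)) ≤ ℓ → ℓ + A ≤ X + D → Y < A → ⊥
      window-overflow {ℓ} {Y} {X} {D} {A} Y≤X lower upper Y<A =
        <⇒≱ Y<A (≤-trans (m≤n+m A r) (+-cancelʳ-≤ (D + (X ∸ Y)) (r + A) Y (begin
          r + A + (D + (X ∸ Y))    ≡⟨ solve 4 (λ r a d z → r :+ a :+ (d :+ z) := d :+ (r :+ z) :+ a)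
                                             refl r A D (X ∸ Y) ⟩
          D + (r + (X ∸ Y)) + A    ≤⟨ +-monoˡ-≤ A lower ⟩
          ℓ + A                    ≤⟨ upper ⟩
          X + D                    ≡⟨ cong (_+ D) (m∸n+n≡m Y≤X) ⟨
          X ∸ Y + Y + D            ≡⟨ solve 3 (λ z y d → z :+ y :+ d := y :+ (d :+ z)) refl (X ∸ Y) Y D ⟩
          Y + (D + (X ∸ Y))        ∎)))
        where
        open ≤-Reasoning
        open +-*-Solver

    module _ (C : Cycle graph) (L-len : L (len C)) {e p} (e<E : e < E) (p<d : p < d e)
             (visits : Visits C (base d e + p)) (below : ∀ i → toℕ (vert C i) < base d (suc e)) where

      private
        lower-bound : d e + gapAfter d e ≤ len C
        lower-bound = FirstFrom⇒≤ (proj₂ (admissible e e<E)) (path≤len C p<d visits) L-len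

        upper-bound : len C ≤ base d e + d e
        upper-bound = len≤ C (base d (suc e)) below

      highest-path-ends-block : suc (e % r) ≡ r
      highest-path-ends-block = decidable-stable (suc (e % r) ≟ r) λ not-last → n≮n (base d e + d e) (begin-strict
        base d e + d e              <⟨ n<1+n _ ⟩
        suc (base d e + d e)        ≡⟨ cong suc (+-comm (base d e) (d e)) ⟩
        suc (d e + base d e)        ≡⟨ +-suc (d e) (base d e) ⟨
        d e + suc (base d e)        ≡⟨ cong (d e +_) (gapAfter-inner d {e} not-last) ⟨
        d e + gapAfter d e          ≤⟨ lower-bound ⟩
        len C                       ≤⟨ upper-bound ⟩
        base d e + d e              ∎)
        where open ≤-Reasoning

      -- Missing a path a of the block would leave fewer than d e + gapAfter d e vertices, as d a > base a.
      highest-block-covered : ∀ s → s < r → Visits C (pair (e / r) s)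
      highest-block-covered s s<r = [ meets , misses ]′ (meets-or-misses-path C a)
        where
        k = e / r
        a = k * r + s
        a≤e : a ≤ e
        a≤e = subst (a ≤_) (sym (trans (m≡m%n+[m/n]*n e r) (+-comm (e % r) (k * r))))
                    (+-monoʳ-≤ (k * r) (s≤s⁻¹ (subst (s <_) (sym highest-path-ends-block) s<r)))
        meets : (∃ λ p′ → p′ < d a × Visits C (base d a + p′)) → Visits C (pair k s)
        meets (p′ , p′<d , visits′) =
          subst (Visits C) (src-path k s<r) (visits-src C (≤-<-trans a≤e e<E) p′<d visits′)
        misses : (∀ i → toℕ (vert C i) < base d a ⊎ base d a + d a ≤ toℕ (vert C i)) → Visits C (pair k s)
        misses avoids = ⊥-elim (window-overflow (base-mono (≤-trans (m≤m+n (k * r) s) a≤e))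
          (subst (λ g → d e + g ≤ len C) (gapAfter-last d {e} highest-path-ends-block) lower-bound)
          (len+gap≤ C (base d (suc e)) (base d a) (d a) below avoids (base-mono (s≤s a≤e)))
          (≤-<-trans (base-mono {k * r} (m≤m+n _ s)) (proj₁ (admissible a (≤-<-trans a≤e e<E)))))

    -- The highest path e of an L-cycle has between d e and base e + d e vertices, which forces it to be the
    -- last path of a block k and the cycle to be at least as long as the block cycle k.
    L-cycle-covers-block : (C : Cycle graph) → L (len C) → ∃ λ k → k < r × (∀ s → s < r → Visits C (pair k s))
    L-cycle-covers-block C L-len =
      let e , e<E , (p , p<d , visits) , below = highest-path C
      in e / r , m<n*o⇒m/o<n e<E , highest-block-covered C L-len e<E p<d visits below

    no-two-disjoint-L-cycles : ¬ HasDisjointLCycles graph L 2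
    no-two-disjoint-L-cycles (Cs , L-Cs , disjoint) =
      let k , k<r , covers = L-cycle-covers-block (Cs zero) (L-Cs zero)
          k′ , k′<r , covers′ = L-cycle-covers-block (Cs (suc zero)) (L-Cs (suc zero))
          i , vi = covers k′ k′<r
          j , vj = covers′ k k<r
      in disjoint zero (suc zero) (λ ()) i j (toℕ-injective (trans vi (trans (pair-comm k k′) (sym vj))))

    block-member : ∀ {k x} → k < r → OnWalk (k * r) r x →
                   (∃ λ s → s < r × x ≡ pair k s) ⊎ (∃ λ a → a / r ≡ k × ∃ λ p → p < d a × x ≡ base d a + p)
    block-member {k} k<r (a , kr≤a , a< , x≡) with block-decompose {k} kr≤a a<
    ... | s , s<r , refl with x≡
    ...   | inj₁ x≡src = inj₁ (s , s<r , trans x≡src (src-path k s<r))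
    ...   | inj₂ (p , p<d , x≡int) = inj₂ (k * r + s , high-digit k s<r , p , p<d , x≡int)

    -- A vertex lies on at most two block cycles, and side tells them apart.
    on-two-blocks : ∀ {k k′ x} → k < r → k′ < r → OnWalk (k * r) r x → OnWalk (k′ * r) r x →
                    side k x ≡ side k′ x → k ≡ k′
    on-two-blocks k<r k′<r on on′ same with block-member k<r on | block-member k′<r on′
    ... | inj₁ (s , s<r , refl) | inj₁ (s′ , s′<r , eq) = side-separates k<r s<r k′<r s′<r eq same
    ... | inj₁ (s , s<r , refl) | inj₂ (a , _ , p , _ , eq) = ⊥-elim (branch≢internal a p (pair< k<r s<r) eq)
    ... | inj₂ (a , _ , p , _ , refl) | inj₁ (s′ , s′<r , eq) =
      ⊥-elim (branch≢internal a p (pair< k′<r s′<r) (sym eq))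
    ... | inj₂ (a , a/r≡k , p , p<d , refl) | inj₂ (a′ , a′/r≡k′ , p′ , p′<d , eq)
      with internal-unique a a′ p<d p′<d eq
    ...   | refl , _ = trans (sym a/r≡k) a′/r≡k′

    -- Each block cycle k either meets X, and is charged to a vertex of X together with its side, or it
    -- survives and its length is listed; no two block cycles get the same charge.
    module Charging (X : Subset (Graph.n graph)) (lengths : List ℕ)
                    (listed : ∀ C → Avoids graph X C → LCycle graph L C → len C ∈ lengths) where

      Witness : ℕ → Set
      Witness k = (∃ λ v → v ∈ₛ X × OnWalk (k * r) r (toℕ v)) ⊎ blockLength k ∈ lengths

      witness : ∀ {k} → k < r → Witness k
      witness {k} k<r = from (blockCycle k<r)
        where
        from : BlockCycle k → Witness k
        from (C , len≡ , on) with any? (λ i → vert C i ∈? X)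
        ... | yes (i , vi∈X) = inj₁ (vert C i , vi∈X , on i)
        ... | no avoids = inj₂ (subst (_∈ lengths) len≡
                                  (listed C (λ i vi∈X → avoids (i , vi∈X)) (subst L (sym len≡) (L-blockLength k<r))))

      encode : ∀ k → Witness k → Fin (∣ X ∣ * 2) ⊎ Fin (length lengths)
      encode k (inj₁ (v , v∈X , _)) = inj₁ (combine (rank X v∈X) (side k (toℕ v)))
      encode k (inj₂ ℓ∈) = inj₂ (index ℓ∈)

      encode-injective : ∀ {k k′} → k < r → k′ < r → (w : Witness k) (w′ : Witness k′) →
                         encode k w ≡ encode k′ w′ → k ≡ k′
      encode-injective {k} {k′} k<r k′<r (inj₁ (v , v∈X , on)) (inj₁ (v′ , v′∈X , on′)) eq
        with combine-injective (rank X v∈X) (side k (toℕ v)) (rank X v′∈X) (side k′ (toℕ v′)) (inj₁-injective eq)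
      ... | rank≡ , side≡ with rank-injective X v∈X v′∈X rank≡
      ...   | refl = on-two-blocks k<r k′<r on on′ side≡
      encode-injective k<r k′<r (inj₂ ℓ∈) (inj₂ ℓ′∈) eq = blockLength-injective k<r k′<r
        (trans (lookup-index ℓ∈) (trans (cong (lookup lengths) (inj₂-injective eq)) (sym (lookup-index ℓ′∈))))
      encode-injective _ _ (inj₁ _) (inj₂ _) ()
      encode-injective _ _ (inj₂ _) (inj₁ _) ()

      code : Fin r → Fin (∣ X ∣ * 2 + length lengths)
      code k = Fin.join (∣ X ∣ * 2) (length lengths) (encode (toℕ k) (witness (toℕ<n k)))

      code-injective : Injective _≡_ _≡_ code
      code-injective {k} {k′} eq = toℕ-injective (encode-injective (toℕ<n k) (toℕ<n k′)
        (witness (toℕ<n k)) (witness (toℕ<n k′)) (join-injective (∣ X ∣ * 2) (length lengths) eq))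

    no-small-hitting-set : ¬ SmallLengthHittingSet graph L t
    no-small-hitting-set (X , ∣X∣≤t , lengths , #lengths≤t , listed) = n≮n (3 * t) (begin-strict
      3 * t                         <⟨ m<n+m (3 * t) {2} z<s ⟩
      r                             ≤⟨ injective⇒≤ (Charging.code-injective X lengths listed) ⟩
      ∣ X ∣ * 2 + length lengths    ≤⟨ +-mono-≤ (*-monoˡ-≤ 2 ∣X∣≤t) #lengths≤t ⟩
      t * 2 + t                     ≡⟨ solve 1 (λ t → t :* con 2 :+ t := con 3 :* t) refl t ⟩
      3 * t                         ∎)
      where
      open ≤-Reasoning
      open +-*-Solver

  open RawMonad (¬¬-Monad {0ℓ}) using (_>>=_; return)

  extend : (ℕ → ℕ) → ℕ → ℕ → ℕ → ℕ
  extend d m x j with j <? m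
  ... | yes _ = d j
  ... | no _ = x

  extend-< : ∀ d {m} x {j} → j < m → extend d m x j ≡ d j
  extend-< d {m} x {j} j<m with j <? m
  ... | yes _ = refl
  ... | no j≮m = ⊥-elim (j≮m j<m)

  extend-≡ : ∀ d m x → extend d m x m ≡ x
  extend-≡ d m x with m <? m
  ... | yes m<m = ⊥-elim (n≮n m m<m)
  ... | no _ = refl

  base-cong : ∀ {d d′} e → (∀ {j} → j < e → d j ≡ d′ j) → base d e ≡ base d′ e
  base-cong zero _ = refl
  base-cong (suc e) agree = cong₂ _+_ (base-cong e (agree ∘ m<n⇒m<1+n)) (agree (n<1+n e))

  gapAfter-cong : ∀ {d d′} e → (∀ {j} → j < e → d j ≡ d′ j) → gapAfter d e ≡ gapAfter d′ e
  gapAfter-cong e agree with suc (e % r) ≟ r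
  ... | yes _ = cong₂ (λ b b′ → r + (b ∸ b′)) (base-cong e agree)
                      (base-cong (e / r * r) (λ j< → agree (<-≤-trans j< (m/n*n≤m e r))))
  ... | no _ = cong suc (base-cong e agree)

  Admissible-cong : ∀ {d d′} e {x} → (∀ {j} → j < e → d j ≡ d′ j) → Admissible d e x → Admissible d′ e x
  Admissible-cong e agree (base<x , first) =
    subst (_< _) (base-cong e agree) base<x , subst (FirstFrom L _) (gapAfter-cong e agree) first

  ¬¬admissibleLengths : Infinite L → Porous L → ∀ m → ¬ ¬ Σ (ℕ → ℕ) λ d → ∀ e → e < m → Admissible d e (d e)
  ¬¬admissibleLengths infinite porous zero = return ((λ _ → 0) , λ _ ())
  ¬¬admissibleLengths infinite porous (suc m) = do
    d , admissible ← ¬¬admissibleLengths infinite porous m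
    x , base<x , first ← ¬¬firstFrom-above infinite porous (base d m) (gapAfter d m)
    return (extend d m x , extended d admissible x (base<x , first))
    where
    extended : ∀ d → (∀ e → e < m → Admissible d e (d e)) → ∀ x → Admissible d m x →
               ∀ e → e < suc m → Admissible (extend d m x) e (extend d m x e)
    extended d admissible x admissible-x e e<m+1 with m≤n⇒m<n∨m≡n (s≤s⁻¹ e<m+1)
    ... | inj₁ e<m = subst (Admissible _ e) (sym (extend-< d x e<m))
                           (Admissible-cong e (λ j<e → sym (extend-< d x (<-trans j<e e<m))) (admissible e e<m))
    ... | inj₂ refl = subst (Admissible _ e) (sym (extend-≡ d e x))
                            (Admissible-cong e (λ j<e → sym (extend-< d x j<e)) admissible-x)

theorem1p4 : (L : ℕ → Set) → Infinite L → Porous L →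
    ¬ (Σ (ℕ → ℕ) λ f → ∀ (k : ℕ) → 1 ≤ k → (G : Graph) →
         HasDisjointLCycles G L k ⊎ SmallLengthHittingSet G L (f k))
theorem1p4 L infinite porous (f , erdős-pósa) =
  ¬¬admissibleLengths infinite porous E λ (d , admissible) →
    let open WithPathLengths d admissible in
    [ no-two-disjoint-L-cycles , no-small-hitting-set ]′ (erdős-pósa 2 (s≤s z≤n) graph)
  where open Counterexample L (f 2)
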